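{- (i) If $w$ is a Dyck word over $\{a,b\}$, then its dual reverse word $\overline{w}$ is also a Dyck word. (ii) Let $M$ be an $n\times n$ $k$-uniform binary matrix and $1\le j\le n-1$. There exists an optimal assignment mapping $\phi_j$ for $M$ if and only if the canonical word $w_j$ of $M$ is a Dyck word.
   Context: A word $w$ over $\{a,b\}$ is a Dyck word if it has equally many $a$'s and $b$'s and every prefix of $w$ has at least as many $a$'s as $b$'s. The dual reverse word $\overline{w}$ is obtained by reversing $w$ and interchanging every $a$ with $b$. For an $n\times n$ binary matrix $M=(m_{i,j})$ ($1\le i,j\le n$), $M$ is $k$-uniform if every row and column contains exactly $k$ ones. For $1\le j\le n-1$: $S_{i,j}=\sum_{l=1}^{j}m_{i,l}$; $X_{1,1}^j=\{i:m_{i,j}=m_{i,j+1}=1\}$, $X_{1,0}^j=\{i:m_{i,j}=1,m_{i,j+1}=0\}$, $X_{0,1}^j=\{i:m_{i,j}=0,m_{i,j+1}=1\}$. An assignment mapping $\phi_j$ is a one-to-one map from $\{i:m_{i,j}=1\}$ onto $\{i:m_{i,j+1}=1\}$; it is optimal if (1) $\phi_j(i)=i\iff m_{i,j}=m_{i,j+1}=1$ for all $i$ in its domain, and (2) $S_{\phi_j(i),j}\le S_{i,j}$ for all $i$ in its domain. The canonical word $w_j$: list the elements of $X_{1,0}^j\cup X_{0,1}^j$ in non-increasing order of $S_{i,j}$, where among equal sums elements of $X_{1,0}^j$ precede those of $X_{0,1}^j$ (ties within one set broken by index), and let the $r$-th letter of $w_j$ be $a$ if the $r$-th listed element is in $X_{1,0}^j$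 and $b$ if it is in $X_{0,1}^j$. -}

module Defs where

open import Data.Bool using (Bool; true; false; if_then_else_; _∧_; _∨_; not; _xor_)
open import Data.Nat using (ℕ; zero; suc; _≤_; _<ᵇ_; _≡ᵇ_; _∸_)
open import Data.Fin using (Fin; toℕ)
import Data.Fin as F
open import Data.List using (List; []; _∷_; _++_; length; filterᵇ; allFin; map; reverse)
open import Data.Product using (_×_; Σ; ∃)
open import Relation.Binary.PropositionalEquality using (_≡_)

data Letter : Set where
  a b : Letter

isA : Letter → Bool
isA a = true
isA b = false

countA countB : List Letter → ℕ
countA w = length (filterᵇ isA w)
countB w = length (filterᵇ (λ x → not (isA x)) w)

IsDyck : List Letter → Set
IsDyck w = (countA w ≡ countB w)
         × (∀ (p s : List Letter) → p ++ s ≡ w → countB p ≤ countA p)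

swapLetter : Letter → Letter
swapLetter a = b
swapLetter b = a

dualReverse : List Letter → List Letter
dualReverse w = reverse (map swapLetter w)

-- Rows/columns are 0-based in Fin n; the paper's 1-based column
-- index c corresponds to the Fin n element with toℕ = c ∸ 1.

Matrix : ℕ → Set
Matrix n = Fin n → Fin n → Bool

countOnes : ∀ {n} → (Fin n → Bool) → ℕ
countOnes {n} f = length (filterᵇ f (allFin n))

KUniform : ∀ {n} → ℕ → Matrix n → Set
KUniform k M = (∀ i → countOnes (λ l → M i l) ≡ k)
             × (∀ l → countOnes (λ i → M i l) ≡ k)

-- look up position c (0-based, as a natural number); false if out of range
lookupℕ : ∀ {n} → (Fin n → Bool) → ℕ → Bool
lookupℕ {zero}  f c       = false
lookupℕ {suc n} f zero    = f F.zero
lookupℕ {suc n} f (suc c) = lookupℕ (λ x → f (F.suc x)) c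

-- m M i c = m_{i,c} with 1-based column index c
m : ∀ {n} → Matrix n → Fin n → ℕ → Bool
m M i c = lookupℕ (M i) (c ∸ 1)

-- S_{i,j} = Σ_{l=1}^{j} m_{i,l}
S : ∀ {n} → Matrix n → Fin n → ℕ → ℕ
S M i j = countOnes (λ l → (toℕ l <ᵇ j) ∧ M i l)

-- Domain {i : m_{i,j} = 1} and codomain {i : m_{i,j+1} = 1}
record AssignmentMapping {n} (M : Matrix n) (j : ℕ) : Set where
  field
    φ       : Fin n → Fin n
    into    : ∀ i → m M i j ≡ true → m M (φ i) (suc j) ≡ true
    inj     : ∀ i i' → m M i j ≡ true → m M i' j ≡ true → φ i ≡ φ i' → i ≡ i'
    onto    : ∀ r → m M r (suc j) ≡ true → Σ (Fin n) (λ i → (m M i j ≡ true) × (φ i ≡ r))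

record IsOptimal {n} {M : Matrix n} {j : ℕ} (A : AssignmentMapping M j) : Set where
  open AssignmentMapping A
  field
    fixed⇒both : ∀ i → m M i j ≡ true → φ i ≡ i → (m M i j ≡ true) × (m M i (suc j) ≡ true)
    both⇒fixed : ∀ i → m M i j ≡ true → (m M i j ≡ true) × (m M i (suc j) ≡ true) → φ i ≡ i
    sumDecr    : ∀ i → m M i j ≡ true → S M (φ i) j ≤ S M i j

inX10 inX01 : ∀ {n} → Matrix n → ℕ → Fin n → Bool
inX10 M j i = m M i j ∧ not (m M i (suc j))
inX01 M j i = not (m M i j) ∧ m M i (suc j)

-- strict "listed before" order: larger S first; equal S: X10 before X01;
-- otherwise (same set) smaller index first.
before : ∀ {n} → Matrix n → ℕ → Fin n → Fin n → Bool
before M j x y =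
  (S M y j <ᵇ S M x j) ∨
  ((S M x j ≡ᵇ S M y j) ∧
    ((inX10 M j x ∧ inX01 M j y) ∨
     ((inX10 M j x ≡ᵇB inX10 M j y) ∧ (toℕ x <ᵇ toℕ y))))
  where
    _≡ᵇB_ : Bool → Bool → Bool
    p ≡ᵇB q = not (p xor q)

insertBy : ∀ {A : Set} → (A → A → Bool) → A → List A → List A
insertBy lt x [] = x ∷ []
insertBy lt x (y ∷ ys) = if lt x y then x ∷ y ∷ ys else y ∷ insertBy lt x ys

sortBy : ∀ {A : Set} → (A → A → Bool) → List A → List A
sortBy lt [] = []
sortBy lt (x ∷ xs) = insertBy lt x (sortBy lt xs)

canonicalList : ∀ {n} → Matrix n → ℕ → List (Fin n)
canonicalList {n} M j =
  sortBy (before M j) (filterᵇ (λ i → inX10 M j i ∨ inX01 M j i) (allFin n))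

canonicalWord : ∀ {n} → Matrix n → ℕ → List Letter
canonicalWord M j = map (λ i → if inX10 M j i then a else b) (canonicalList M j)

-- (i) A prefix of the dual reverse of w is the dual reverse of a suffix of w,
-- and a suffix of a Dyck word has at least as many b's as a's.
--
-- (ii) Give each row i ∈ X₁₀ ∪ X₀₁ the key 2 S_{i,j} + [i ∈ X₁₀]. The canonical
-- list is sorted by decreasing key, and a row of X₁₀ outranks a row of X₀₁
-- exactly when its row sum is at least as large. On X₁₀ an optimal assignment
-- is therefore a bijection onto X₀₁ that decreases keys, and conversely such a
-- bijection extends by the identity on X₁₁ to an optimal assignment. Finally, a
-- list sorted by decreasing key spells a Dyck word iff such a key-decreasing
-- matching of its a's onto its b's exists: given the matching, every b of a
-- prefix has its partner inside the prefix, so pigeonhole bounds the b's by the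
-- a's; given a Dyck word, pairing the i-th a with the i-th b works.
module Submission where

open import Defs
open import Data.Bool using (Bool; true; false; if_then_else_; not; T; _∧_; _∨_; _xor_)
open import Data.Nat using (ℕ; zero; suc; _+_; _∸_; _≤_; _<_; z≤n; s≤s; s≤s⁻¹; _<ᵇ_; _≡ᵇ_)
open import Data.Nat.Properties
  using (+-comm; +-suc; suc-injective; ≤-refl; ≤-reflexive; ≤-trans; ≤-antisym; n≤1+n; +-monoˡ-≤; +-mono-≤;
         +-mono-<; +-cancelˡ-≤; ≮⇒≥; <⇒≱; ≤∧≢⇒<; <ᵇ⇒<; <⇒<ᵇ; ≡ᵇ⇒≡; ≡⇒≡ᵇ; module ≤-Reasoning)
open import Data.Fin using (Fin; toℕ; _≟_)
open import Data.List using (List; []; _∷_; _++_; [_]; length; map; reverse; filterᵇ; take; zip; allFin)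
open import Data.List.Properties
  using (∷-injective; length-++; length-++-sucʳ; ++-assoc; ++-identityʳ; take++drop≡id; filter-++; map-++;
         reverse-++; reverse-map; reverse-involutive)
open import Data.List.Relation.Unary.All using (All; []; _∷_)
import Data.List.Relation.Unary.All as All
import Data.List.Relation.Unary.All.Properties as All
open import Data.List.Relation.Unary.AllPairs using (AllPairs; []; _∷_)
open import Data.List.Relation.Unary.Any using (here; there)
open import Data.List.Relation.Unary.Unique.Propositional using (Unique)
import Data.List.Relation.Unary.Unique.Propositional.Properties as Unique
open import Data.List.Membership.Propositional using (_∈_)
open import Data.List.Membership.Propositional.Properties
  using (∈-∃++; ∈-++⁺ˡ; ∈-++⁺ʳ; ∈-++⁻; ∈-filter⁺; ∈-filter⁻; ∈-allFin)
open import Data.List.Relation.Binary.Permutation.Propositional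
  using (_↭_; ↭-refl; ↭-prep; ↭-swap; ↭-trans; ↭-sym; ↭⇒↭ₛ)
open import Data.List.Relation.Binary.Permutation.Propositional.Properties using (All-resp-↭; ∈-resp-↭)
import Data.List.Relation.Binary.Permutation.Setoid.Properties as ↭ₛ
open import Data.Product using (Σ; _×_; _,_; proj₁; proj₂; ∃-syntax; map₂)
import Data.Product as Product
open import Data.Sum using (inj₁; inj₂)
open import Data.Empty using (⊥-elim)
open import Data.Unit using (tt)
open import Function using (_∘_)
open import Function.Bundles using (_⇔_; mk⇔; Equivalence)
open import Relation.Nullary.Decidable using (T?; does; yes; no)
open import Relation.Nullary.Negation using (contradiction)
open import Relation.Binary.Definitions using (DecidableEquality)
open import Relation.Binary.PropositionalEquality hiding ([_])

countA-++ : ∀ u v → countA (u ++ v) ≡ countA u + countA v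
countA-++ u v = trans (cong length (filter-++ (T? ∘ isA) u v)) (length-++ (filterᵇ isA u))

countB-++ : ∀ u v → countB (u ++ v) ≡ countB u + countB v
countB-++ u v = trans (cong length (filter-++ (T? ∘ (not ∘ isA)) u v)) (length-++ (filterᵇ (not ∘ isA) u))

dualReverse-++ : ∀ u v → dualReverse (u ++ v) ≡ dualReverse v ++ dualReverse u
dualReverse-++ u v = trans (cong reverse (map-++ swapLetter u v)) (reverse-++ (map swapLetter u) _)

swapLetter-involutive : ∀ x → swapLetter (swapLetter x) ≡ x
swapLetter-involutive a = refl
swapLetter-involutive b = refl

dualReverse-involutive : ∀ w → dualReverse (dualReverse w) ≡ w
dualReverse-involutive w = begin
  reverse (map swapLetter (reverse (map swapLetter w)))
    ≡⟨ cong reverse (reverse-map swapLetter (map swapLetter w)) ⟩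
  reverse (reverse (map swapLetter (map swapLetter w)))
    ≡⟨ reverse-involutive _ ⟩
  map swapLetter (map swapLetter w)
    ≡⟨ map-swapLetter-involutive w ⟩
  w ∎
  where
  open ≡-Reasoning
  map-swapLetter-involutive : ∀ w → map swapLetter (map swapLetter w) ≡ w
  map-swapLetter-involutive []      = refl
  map-swapLetter-involutive (x ∷ w) = cong₂ _∷_ (swapLetter-involutive x) (map-swapLetter-involutive w)

countA-swapLetter : ∀ x → countA [ swapLetter x ] ≡ countB [ x ]
countA-swapLetter a = refl
countA-swapLetter b = refl

countA-dualReverse : ∀ w → countA (dualReverse w) ≡ countB w
countA-dualReverse []      = refl
countA-dualReverse (x ∷ w) = begin
  countA (dualReverse (x ∷ w))                     ≡⟨ cong countA (dualReverse-++ [ x ] w) ⟩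
  countA (dualReverse w ++ [ swapLetter x ])       ≡⟨ countA-++ (dualReverse w) _ ⟩
  countA (dualReverse w) + countA [ swapLetter x ] ≡⟨ cong₂ _+_ (countA-dualReverse w) (countA-swapLetter x) ⟩
  countB w + countB [ x ]                          ≡⟨ +-comm (countB w) _ ⟩
  countB [ x ] + countB w                          ≡⟨ countB-++ [ x ] w ⟨
  countB (x ∷ w)                                   ∎
  where open ≡-Reasoning

countB-dualReverse : ∀ w → countB (dualReverse w) ≡ countA w
countB-dualReverse w = begin
  countB (dualReverse w)               ≡⟨ countA-dualReverse (dualReverse w) ⟨
  countA (dualReverse (dualReverse w)) ≡⟨ cong countA (dualReverse-involutive w) ⟩
  countA w                             ∎
  where open ≡-Reasoning

Dyck-suffix : ∀ u v → IsDyck (u ++ v) → countA v ≤ countB v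
Dyck-suffix u v (balanced , prefixes) = +-cancelˡ-≤ (countB u) _ _ (begin
  countB u + countA v ≤⟨ +-monoˡ-≤ (countA v) (prefixes u v refl) ⟩
  countA u + countA v ≡⟨ countA-++ u v ⟨
  countA (u ++ v)     ≡⟨ balanced ⟩
  countB (u ++ v)     ≡⟨ countB-++ u v ⟩
  countB u + countB v ∎)
  where open ≤-Reasoning

Dyck-dualReverse : ∀ w → IsDyck w → IsDyck (dualReverse w)
Dyck-dualReverse w dyck@(balanced , _) = balanced′ , prefixes′
  where
  balanced′ : countA (dualReverse w) ≡ countB (dualReverse w)
  balanced′ = trans (countA-dualReverse w) (trans (sym balanced) (sym (countB-dualReverse w)))
  prefixes′ : ∀ p s → p ++ s ≡ dualReverse w → countB p ≤ countA p
  prefixes′ p s eq = subst₂ _≤_ (countA-dualReverse p) (countB-dualReverse p)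
    (Dyck-suffix (dualReverse s) (dualReverse p) (subst IsDyck w≡ dyck))
    where
    w≡ : w ≡ dualReverse s ++ dualReverse p
    w≡ = trans (sym (dualReverse-involutive w)) (trans (cong dualReverse (sym eq)) (dualReverse-++ p s))

length-≤-by-injection : ∀ {A B : Set} (R : A → B → Set) {xs : List A} {ys : List B} → Unique xs →
  (∀ {x} → x ∈ xs → ∃[ y ] y ∈ ys × R x y) →
  (∀ {x x′ y} → x ∈ xs → x′ ∈ xs → R x y → R x′ y → x ≡ x′) →
  length xs ≤ length ys
length-≤-by-injection R {[]} _ _ _ = z≤n
length-≤-by-injection R {x ∷ xs} {ys} (x∉xs ∷ xs!) image injective with image (here refl)
... | y , y∈ys , Rxy with ∈-∃++ y∈ys
... | us , vs , refl = subst (suc (length xs) ≤_) (sym (length-++-sucʳ us y vs))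
        (s≤s (length-≤-by-injection R xs! image′ (λ x∈ x′∈ → injective (there x∈) (there x′∈))))
  where
  image′ : ∀ {x′} → x′ ∈ xs → ∃[ y′ ] y′ ∈ us ++ vs × R x′ y′
  image′ x′∈xs with image (there x′∈xs)
  ... | y′ , y′∈ , Rx′y′ with ∈-++⁻ us y′∈
  ... | inj₁ y′∈us          = y′ , ∈-++⁺ˡ y′∈us , Rx′y′
  ... | inj₂ (there y′∈vs)  = y′ , ∈-++⁺ʳ us y′∈vs , Rx′y′
  ... | inj₂ (here refl)    =
        ⊥-elim (All.lookup x∉xs x′∈xs (injective (here refl) (there x′∈xs) Rxy Rx′y′))

AllPairs-++⇒ : ∀ {A : Set} {R : A → A → Set} xs {ys u v} →
  AllPairs R (xs ++ ys) → u ∈ xs → v ∈ ys → R u v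
AllPairs-++⇒ (x ∷ xs) (x~ ∷ _) (here refl) v∈ys = All.lookup (All.++⁻ʳ xs x~) v∈ys
AllPairs-++⇒ (x ∷ xs) (_ ∷ xs~) (there u∈xs) v∈ys = AllPairs-++⇒ xs xs~ u∈xs v∈ys

prefix-of-map : ∀ {A B : Set} (f : A → B) p s xs → p ++ s ≡ map f xs → p ≡ map f (take (length p) xs)
prefix-of-map f []      s xs       eq = refl
prefix-of-map f (c ∷ p) s (x ∷ xs) eq =
  cong₂ _∷_ (proj₁ (∷-injective eq)) (prefix-of-map f p s xs (proj₂ (∷-injective eq)))

Descending : ∀ {A : Set} → (A → ℕ) → List A → Set
Descending K = AllPairs (λ x y → K y ≤ K x)

module _ {A : Set} (lt : A → A → Bool) where

  insertBy-↭ : ∀ x ys → insertBy lt x ys ↭ x ∷ ys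
  insertBy-↭ x []       = ↭-refl
  insertBy-↭ x (y ∷ ys) with lt x y
  ... | true  = ↭-refl
  ... | false = ↭-trans (↭-prep y (insertBy-↭ x ys)) (↭-swap y x ↭-refl)

  sortBy-↭ : ∀ xs → sortBy lt xs ↭ xs
  sortBy-↭ []       = ↭-refl
  sortBy-↭ (x ∷ xs) = ↭-trans (insertBy-↭ x (sortBy lt xs)) (↭-prep x (sortBy-↭ xs))

  module _ (K : A → ℕ) {Q : A → Set}
           (lt⇒≥ : ∀ {x y} → Q x → Q y → lt x y ≡ true → K y ≤ K x)
           (¬lt⇒≤ : ∀ {x y} → Q x → Q y → lt x y ≡ false → K x ≤ K y) where

    insertBy-descending : ∀ {x ys} → Q x → All Q ys → Descending K ys → Descending K (insertBy lt x ys)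
    insertBy-descending {x} {[]}     _  _          _ = [] ∷ []
    insertBy-descending {x} {y ∷ ys} qx (qy ∷ qys) (y≥ys ∷ ys↓) with lt x y in lt-xy
    ... | true  = (x≥y ∷ All.map (λ y≥z → ≤-trans y≥z x≥y) y≥ys) ∷ y≥ys ∷ ys↓
      where x≥y = lt⇒≥ qx qy lt-xy
    ... | false = All-resp-↭ (↭-sym (insertBy-↭ x ys)) (¬lt⇒≤ qx qy lt-xy ∷ y≥ys)
                ∷ insertBy-descending qx qys ys↓

    sortBy-descending : ∀ {xs} → All Q xs → Descending K (sortBy lt xs)
    sortBy-descending {[]}     []         = []
    sortBy-descending {x ∷ xs} (qx ∷ qxs) =
      insertBy-descending qx (All-resp-↭ (↭-sym (sortBy-↭ xs)) qxs) (sortBy-descending qxs)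

-- Ballot d w: reading a as a step up and b as a step down, w leads from
-- height d to height 0 without going below 0.
data Ballot : ℕ → List Letter → Set where
  done : Ballot 0 []
  up   : ∀ {d w} → Ballot (suc d) w → Ballot d (a ∷ w)
  down : ∀ {d w} → Ballot d w → Ballot (suc d) (b ∷ w)

counts⇒Ballot : ∀ d w → (∀ p s → p ++ s ≡ w → countB p ≤ d + countA p) →
  d + countA w ≡ countB w → Ballot d w
counts⇒Ballot zero    []      _        _        = done
counts⇒Ballot (suc d) []      _        ()
counts⇒Ballot d       (a ∷ w) prefixes balanced =
  up (counts⇒Ballot (suc d) w prefixes′ (trans (sym (+-suc d _)) balanced))
  where
  prefixes′ : ∀ p s → p ++ s ≡ w → countB p ≤ suc d + countA p
  prefixes′ p s eq = subst (countB p ≤_) (+-suc d _) (prefixes (a ∷ p) s (cong (a ∷_) eq))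
counts⇒Ballot zero    (b ∷ w) prefixes _ with () ← prefixes [ b ] w refl
counts⇒Ballot (suc d) (b ∷ w) prefixes balanced = down (counts⇒Ballot d w prefixes′ (suc-injective balanced))
  where
  prefixes′ : ∀ p s → p ++ s ≡ w → countB p ≤ d + countA p
  prefixes′ p s eq = s≤s⁻¹ (prefixes (b ∷ p) s (cong (b ∷_) eq))

Dyck⇒Ballot : ∀ {w} → IsDyck w → Ballot 0 w
Dyck⇒Ballot {w} (balanced , prefixes) = counts⇒Ballot 0 w prefixes balanced

module _ {A B : Set} where

  zip-∈⁻ : ∀ {xs : List A} {ys : List B} {x y} → (x , y) ∈ zip xs ys → x ∈ xs × y ∈ ys
  zip-∈⁻ {[]}    ()
  zip-∈⁻ {_ ∷ _} {[]} ()
  zip-∈⁻ {_ ∷ _} {_ ∷ _} (here refl)  = here refl , here refl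
  zip-∈⁻ {_ ∷ _} {_ ∷ _} (there xy∈) = Product.map there there (zip-∈⁻ xy∈)

  zip-coversˡ : ∀ {xs : List A} {ys : List B} {x} → x ∈ xs → length xs ≤ length ys →
    ∃[ y ] (x , y) ∈ zip xs ys
  zip-coversˡ {_ ∷ _} {y ∷ _} (here refl) _         = y , here refl
  zip-coversˡ {_ ∷ _} {_ ∷ _} (there x∈)  (s≤s len) = map₂ there (zip-coversˡ x∈ len)

  zip-coversʳ : ∀ {xs : List A} {ys : List B} {y} → y ∈ ys → length ys ≤ length xs →
    ∃[ x ] (x , y) ∈ zip xs ys
  zip-coversʳ {x ∷ _} {_ ∷ _} (here refl) _         = x , here refl
  zip-coversʳ {_ ∷ _} {_ ∷ _} (there y∈)  (s≤s len) = map₂ there (zip-coversʳ y∈ len)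

  zip-injectiveʳ : ∀ {xs : List A} {ys : List B} {x x′ y} → Unique ys →
    (x , y) ∈ zip xs ys → (x′ , y) ∈ zip xs ys → x ≡ x′
  zip-injectiveʳ {_ ∷ _} {_ ∷ _} _          (here refl) (here refl)  = refl
  zip-injectiveʳ {_ ∷ _} {_ ∷ _} (y∉ys ∷ _) (here refl) (there x′y∈) =
    ⊥-elim (All.lookup y∉ys (proj₂ (zip-∈⁻ x′y∈)) refl)
  zip-injectiveʳ {_ ∷ _} {_ ∷ _} (y∉ys ∷ _) (there xy∈) (here refl)  =
    ⊥-elim (All.lookup y∉ys (proj₂ (zip-∈⁻ xy∈)) refl)
  zip-injectiveʳ {_ ∷ _} {_ ∷ _} (_ ∷ ys!)  (there xy∈) (there x′y∈) = zip-injectiveʳ ys! xy∈ x′y∈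

module _ {A : Set} (_≟_ : DecidableEquality A) where

  pairing : List A → List A → A → A
  pairing (x ∷ xs) (y ∷ ys) z = if does (z ≟ x) then y else pairing xs ys z
  pairing _        _        z = z

  pairing-zip : ∀ {xs ys x y} → Unique xs → (x , y) ∈ zip xs ys → pairing xs ys x ≡ y
  pairing-zip {x₀ ∷ xs} {_ ∷ ys} {x} (x₀∉xs ∷ xs!) xy∈ with x ≟ x₀ | xy∈
  ... | yes _    | here refl  = refl
  ... | no x≢x₀  | here refl  = ⊥-elim (x≢x₀ refl)
  ... | yes refl | there xy∈′ = ⊥-elim (All.lookup x₀∉xs (proj₁ (zip-∈⁻ xy∈′)) refl)
  ... | no _     | there xy∈′ = pairing-zip xs! xy∈′

module _ {A : Set} (tag : A → Bool) where

  word : List A → List Letter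
  word = map (λ x → if tag x then a else b)

  tagged untagged : List A → List A
  tagged   = filterᵇ tag
  untagged = filterᵇ (not ∘ tag)

  countA-word : ∀ xs → countA (word xs) ≡ length (tagged xs)
  countA-word []       = refl
  countA-word (x ∷ xs) with tag x
  ... | true  = cong suc (countA-word xs)
  ... | false = countA-word xs

  countB-word : ∀ xs → countB (word xs) ≡ length (untagged xs)
  countB-word []       = refl
  countB-word (x ∷ xs) with tag x
  ... | true  = countB-word xs
  ... | false = cong suc (countB-word xs)

  module _ (K : A → ℕ) where

    record Matching (xs : List A) : Set where
      field
        pair      : A → A
        pair-into : ∀ {x} → x ∈ tagged xs → pair x ∈ untagged xs
        pair-inj  : ∀ {x x′} → x ∈ tagged xs → x′ ∈ tagged xs → pair x ≡ pair x′ → x ≡ x′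
        pair-onto : ∀ {y} → y ∈ untagged xs → ∃[ x ] x ∈ tagged xs × pair x ≡ y
        pair-<    : ∀ {x} → x ∈ tagged xs → K (pair x) < K x

    take-balanced : ∀ {xs} → Unique xs → Descending K xs → Matching xs →
      ∀ k → length (untagged (take k xs)) ≤ length (tagged (take k xs))
    take-balanced {xs} xs! xs↓ μ k =
      length-≤-by-injection (λ y x → pair x ≡ y) (Unique.filter⁺ _ (Unique.take⁺ k xs!)) preimage
        (λ _ _ e e′ → trans (sym e) e′)
      where
      open Matching μ
      split : take k xs ++ _ ≡ xs
      split = take++drop≡id k xs
      y∈xs : ∀ {y} → y ∈ take k xs → y ∈ xs
      y∈xs y∈take = subst (_ ∈_) split (∈-++⁺ˡ y∈take)
      preimage : ∀ {y} → y ∈ untagged (take k xs) → ∃[ x ] x ∈ tagged (take k xs) × pair x ≡ y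
      preimage y∈ with y∈take , untag-y ← ∈-filter⁻ (T? ∘ (not ∘ tag)) y∈
                  with x , x∈ , refl ← pair-onto (∈-filter⁺ (T? ∘ (not ∘ tag)) (y∈xs y∈take) untag-y)
                  with x∈xs , tag-x ← ∈-filter⁻ (T? ∘ tag) x∈
                  with ∈-++⁻ (take k xs) (subst (_ ∈_) (sym split) x∈xs)
      ... | inj₁ x∈take = x , ∈-filter⁺ (T? ∘ tag) x∈take tag-x , refl
      ... | inj₂ x∈drop = ⊥-elim (<⇒≱ (pair-< x∈)
              (AllPairs-++⇒ (take k xs) (subst (Descending K) (sym split) xs↓) y∈take x∈drop))

    matching⇒Dyck : ∀ {xs} → Unique xs → Descending K xs → Matching xs → IsDyck (word xs)
    matching⇒Dyck {xs} xs! xs↓ μ = ≤-antisym A≤B (prefixes (word xs) [] (++-identityʳ _)) , prefixes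
      where
      open Matching μ
      prefixes : ∀ p s → p ++ s ≡ word xs → countB p ≤ countA p
      prefixes p s eq = subst (λ q → countB q ≤ countA q) (sym (prefix-of-map _ p s xs eq))
        (subst₂ _≤_ (sym (countB-word (take k xs))) (sym (countA-word (take k xs))) (take-balanced xs! xs↓ μ k))
        where k = length p
      A≤B : countA (word xs) ≤ countB (word xs)
      A≤B = subst₂ _≤_ (sym (countA-word xs)) (sym (countB-word xs))
        (length-≤-by-injection (λ x y → pair x ≡ y) (Unique.filter⁺ _ xs!)
          (λ x∈ → pair _ , pair-into x∈ , refl)
          (λ x∈ x′∈ e e′ → pair-inj x∈ x′∈ (trans e (sym e′))))

    -- The i-th tagged element is paired with the i-th untagged one; st holds the
    -- tagged elements seen but not yet paired.
    zip-descends : ∀ {d} st xs → length st ≡ d → Descending K xs → All (λ s → All (λ y → K y ≤ K s) xs) st →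
      Ballot d (word xs) → ∀ {x y} → (x , y) ∈ zip (st ++ tagged xs) (untagged xs) → K y ≤ K x
    zip-descends []      []       _ _ _ _ ()
    zip-descends (_ ∷ _) []       _ _ _ _ ()
    zip-descends st      (z ∷ xs) len (z≥xs ∷ xs↓) st≥ path xy∈ with tag z
    zip-descends st (z ∷ xs) refl (z≥xs ∷ xs↓) st≥ (up path) {x} {y} xy∈ | true =
      zip-descends (st ++ [ z ]) xs (trans (length-++ st) (+-comm _ 1)) xs↓
        (All.++⁺ (All.map All.tail st≥) (z≥xs ∷ [])) path
        (subst (λ l → (x , y) ∈ zip l (untagged xs)) (sym (++-assoc st [ z ] (tagged xs))) xy∈)
    zip-descends []       (z ∷ xs) refl _ _ () _ | false
    zip-descends (s ∷ st) (z ∷ xs) refl _ ((s≥z ∷ _) ∷ _) (down path) (here refl) | false = s≥z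
    zip-descends (s ∷ st) (z ∷ xs) refl (_ ∷ xs↓) (_ ∷ st≥) (down path) (there xy∈) | false =
      zip-descends st xs refl xs↓ (All.map All.tail st≥) path xy∈

    Dyck⇒matching : ∀ {xs} → DecidableEquality A → Unique xs → Descending K xs →
      (∀ {x y} → x ∈ tagged xs → y ∈ untagged xs → K x ≢ K y) → IsDyck (word xs) → Matching xs
    Dyck⇒matching {xs} _≟_ xs! xs↓ separated dyck = record
      { pair      = pair
      ; pair-into = λ x∈ → proj₂ (zip-∈⁻ (paired x∈))
      ; pair-inj  = λ x∈ x′∈ e → zip-injectiveʳ (Unique.filter⁺ _ xs!) (paired x∈)
                                   (subst (λ y → (_ , y) ∈ zip _ _) (sym e) (paired x′∈))
      ; pair-onto = onto
      ; pair-<    = λ x∈ → ≤∧≢⇒< (zip-descends [] xs refl xs↓ [] (Dyck⇒Ballot dyck) (paired x∈))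
                                  (≢-sym (separated x∈ (proj₂ (zip-∈⁻ (paired x∈)))))
      }
      where
      same-length : length (tagged xs) ≡ length (untagged xs)
      same-length = trans (sym (countA-word xs)) (trans (proj₁ dyck) (countB-word xs))
      pair : A → A
      pair = pairing _≟_ (tagged xs) (untagged xs)
      paired : ∀ {x} → x ∈ tagged xs → (x , pair x) ∈ zip (tagged xs) (untagged xs)
      paired {x} x∈ with y , xy∈ ← zip-coversˡ x∈ (≤-reflexive same-length) =
        subst (λ y → (x , y) ∈ zip (tagged xs) (untagged xs))
              (sym (pairing-zip _≟_ (Unique.filter⁺ _ xs!) xy∈)) xy∈
      onto : ∀ {y} → y ∈ untagged xs → ∃[ x ] x ∈ tagged xs × pair x ≡ y
      onto y∈ with x , xy∈ ← zip-coversʳ y∈ (≤-reflexive (sym same-length)) =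
        x , proj₁ (zip-∈⁻ xy∈) , pairing-zip _≟_ (Unique.filter⁺ _ xs!) xy∈

-- Sorting by key p s decreasingly is sorting by s decreasingly, breaking ties
-- in favour of p = true.
key : Bool → ℕ → ℕ
key false s = s + s
key true  s = suc (s + s)

key-≤-odd : ∀ p s → key p s ≤ suc (s + s)
key-≤-odd false s = n≤1+n _
key-≤-odd true  s = ≤-refl

even-≤-key : ∀ p s → s + s ≤ key p s
even-≤-key false s = ≤-refl
even-≤-key true  s = n≤1+n _

key-mono : ∀ p q {s t} → t < s → key q t ≤ key p s
key-mono p q {s} {t} t<s = ≤-trans (key-≤-odd q t) (≤-trans (+-mono-< t<s t<s) (even-≤-key p s))

key-false<key-true : ∀ {s t} → t ≤ s → key false t < key true s
key-false<key-true t≤s = s≤s (+-mono-≤ t≤s t≤s)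

key-false<key-true⁻¹ : ∀ {s t} → key false t < key true s → t ≤ s
key-false<key-true⁻¹ t<s = ≮⇒≥ (λ s<t → <⇒≱ (+-mono-< s<t s<t) (s≤s⁻¹ t<s))

key-true≢key-false : ∀ s t → key true s ≢ key false t
key-true≢key-false s zero    ()
key-true≢key-false s (suc t) e = key-true≢key-false t s (sym (trans (suc-injective e) (+-suc t t)))

-- The comparison `before` of Defs, with sx, px, ix (resp. sy, py, qy, iy) the
-- row sum, membership in X₁₀ and index of x (resp. of y, and membership in X₀₁).
Before : (sx sy : ℕ) (px py qy : Bool) (ix iy : ℕ) → Bool
Before sx sy px py qy ix iy = (sy <ᵇ sx) ∨ ((sx ≡ᵇ sy) ∧ ((px ∧ qy) ∨ (not (px xor py) ∧ (ix <ᵇ iy))))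

Before⇒key≥ : ∀ sx sy px py qy ix iy → Before sx sy px py qy ix iy ≡ true → key py sy ≤ key px sx
Before⇒key≥ sx sy px py qy ix iy before with sy <ᵇ sx in lt | sx ≡ᵇ sy in eq
... | true  | _    = key-mono px py (<ᵇ⇒< sy sx (subst T (sym lt) tt))
... | false | true with refl ← ≡ᵇ⇒≡ sx sy (subst T (sym eq) tt) = tie px py qy before
  where
  tie : ∀ px py qy → ((px ∧ qy) ∨ (not (px xor py) ∧ (ix <ᵇ iy))) ≡ true → key py sx ≤ key px sx
  tie true  true  _ _ = ≤-refl
  tie false false _ _ = ≤-refl
  tie true  false _ _ = n≤1+n _

Before⇒key≤ : ∀ sx sy px py qy ix iy → T (py ∨ qy) →
  Before sx sy px py qy ix iy ≡ false → key px sx ≤ key py sy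
Before⇒key≤ sx sy px py qy ix iy y∈X before with sy <ᵇ sx in lt | sx ≡ᵇ sy in eq
... | false | true with refl ← ≡ᵇ⇒≡ sx sy (subst T (sym eq) tt) = tie px py qy y∈X before
  where
  tie : ∀ px py qy → T (py ∨ qy) →
    ((px ∧ qy) ∨ (not (px xor py) ∧ (ix <ᵇ iy))) ≡ false → key px sx ≤ key py sx
  tie true  true  _    _ _ = ≤-refl
  tie false false _    _ _ = ≤-refl
  tie false true  _    _ _ = n≤1+n _
  tie true  false false () _
  tie true  false true  _ ()
... | false | false = key-mono py px (≤∧≢⇒< (≮⇒≥ (λ sy<sx → subst T lt (<⇒<ᵇ sy<sx)))
                                             (λ sx≡sy → subst T eq (≡⇒≡ᵇ sx sy sx≡sy)))

module CanonicalWord {n : ℕ} (M : Matrix n) (j : ℕ) where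

  inX10∪X01 : Fin n → Bool
  inX10∪X01 i = inX10 M j i ∨ inX01 M j i

  K : Fin n → ℕ
  K i = key (inX10 M j i) (S M i j)

  L X₁₀ X₀₁ : List (Fin n)
  L   = canonicalList M j
  X₁₀ = tagged (inX10 M j) L
  X₀₁ = untagged (inX10 M j) L

  L-↭ : L ↭ filterᵇ inX10∪X01 (allFin n)
  L-↭ = sortBy-↭ (before M j) (filterᵇ inX10∪X01 (allFin n))

  L-unique : Unique L
  L-unique = ↭ₛ.Unique-resp-↭ (setoid (Fin n)) (↭⇒↭ₛ (↭-sym L-↭))
    (Unique.filter⁺ (T? ∘ inX10∪X01) (Unique.allFin⁺ n))

  L-descending : Descending K L
  L-descending = sortBy-descending (before M j) K
    (λ {x} {y} _ _ →
      Before⇒key≥ (S M x j) (S M y j) (inX10 M j x) (inX10 M j y) (inX01 M j y) (toℕ x) (toℕ y))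
    (λ {x} {y} _ y∈X →
      Before⇒key≤ (S M x j) (S M y j) (inX10 M j x) (inX10 M j y) (inX01 M j y) (toℕ x) (toℕ y) y∈X)
    (All.all-filter (T? ∘ inX10∪X01) (allFin n))

  ∈-L⁺ : ∀ {i} → T (inX10∪X01 i) → i ∈ L
  ∈-L⁺ {i} i∈X = ∈-resp-↭ (↭-sym L-↭) (∈-filter⁺ (T? ∘ inX10∪X01) (∈-allFin i) i∈X)

  ∈-L⁻ : ∀ {i} → i ∈ L → T (inX10∪X01 i)
  ∈-L⁻ i∈ = proj₂ (∈-filter⁻ (T? ∘ inX10∪X01) {xs = allFin n} (∈-resp-↭ L-↭ i∈))

  ∈-X₁₀⁺ : ∀ {i} → m M i j ≡ true → m M i (suc j) ≡ false → i ∈ X₁₀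
  ∈-X₁₀⁺ {i} mᵢ mᵢ′ = ∈-filter⁺ (T? ∘ inX10 M j) (∈-L⁺ i∈X) i∈X10
    where
    i∈X : T (inX10∪X01 i)
    i∈X rewrite mᵢ | mᵢ′ = tt
    i∈X10 : T (inX10 M j i)
    i∈X10 rewrite mᵢ | mᵢ′ = tt

  ∈-X₁₀⁻ : ∀ {i} → i ∈ X₁₀ → m M i j ≡ true × m M i (suc j) ≡ false
  ∈-X₁₀⁻ {i} i∈ with _ , i∈X10 ← ∈-filter⁻ (T? ∘ inX10 M j) {xs = L} i∈ with m M i j | m M i (suc j)
  ... | true | false = refl , refl

  ∈-X₀₁⁺ : ∀ {i} → m M i j ≡ false → m M i (suc j) ≡ true → i ∈ X₀₁
  ∈-X₀₁⁺ {i} mᵢ mᵢ′ = ∈-filter⁺ (T? ∘ (not ∘ inX10 M j)) (∈-L⁺ i∈X) i∉X10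
    where
    i∈X : T (inX10∪X01 i)
    i∈X rewrite mᵢ | mᵢ′ = tt
    i∉X10 : T (not (inX10 M j i))
    i∉X10 rewrite mᵢ = tt

  ∈-X₀₁⁻ : ∀ {i} → i ∈ X₀₁ → m M i j ≡ false × m M i (suc j) ≡ true
  ∈-X₀₁⁻ {i} i∈ with i∈L , i∉X10 ← ∈-filter⁻ (T? ∘ (not ∘ inX10 M j)) {xs = L} i∈
                with i∈X ← ∈-L⁻ i∈L
                with m M i j | m M i (suc j)
  ... | false | true  = refl , refl
  ... | true  | false = ⊥-elim i∉X10
  ... | false | false = ⊥-elim i∈X

  K-X₁₀ : ∀ {i} → i ∈ X₁₀ → K i ≡ key true (S M i j)
  K-X₁₀ {i} i∈ = cong₂ (λ p q → key (p ∧ not q) (S M i j)) (proj₁ (∈-X₁₀⁻ i∈)) (proj₂ (∈-X₁₀⁻ i∈))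

  K-X₀₁ : ∀ {i} → i ∈ X₀₁ → K i ≡ key false (S M i j)
  K-X₀₁ {i} i∈ = cong₂ (λ p q → key (p ∧ not q) (S M i j)) (proj₁ (∈-X₀₁⁻ i∈)) (proj₂ (∈-X₀₁⁻ i∈))

  K-separated : ∀ {x y} → x ∈ X₁₀ → y ∈ X₀₁ → K x ≢ K y
  K-separated {x} {y} x∈ y∈ e =
    key-true≢key-false (S M x j) (S M y j) (trans (sym (K-X₁₀ x∈)) (trans e (K-X₀₁ y∈)))

  K<K⇔S≤S : ∀ {x y} → x ∈ X₁₀ → y ∈ X₀₁ → K y < K x ⇔ S M y j ≤ S M x j
  K<K⇔S≤S x∈ y∈ = mk⇔
    (λ Ky<Kx → key-false<key-true⁻¹ (subst₂ _<_ (K-X₀₁ y∈) (K-X₁₀ x∈) Ky<Kx))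
    (λ Sy≤Sx → subst₂ _<_ (sym (K-X₀₁ y∈)) (sym (K-X₁₀ x∈)) (key-false<key-true Sy≤Sx))

  module FromOptimal (A : AssignmentMapping M j) (optimal : IsOptimal A) where
    open AssignmentMapping A
    open IsOptimal optimal

    φ-leaves : ∀ {i} → i ∈ X₁₀ → m M (φ i) j ≡ false
    φ-leaves {i} i∈ with m M (φ i) j in m-φi
    ... | false = refl
    ... | true  = contradiction
                    (trans (sym mᵢ′) (subst (λ r → m M r (suc j) ≡ true) (sym i≡φi) (into i mᵢ)))
                    λ ()
      where
      mᵢ  = proj₁ (∈-X₁₀⁻ i∈)
      mᵢ′ = proj₂ (∈-X₁₀⁻ i∈)
      i≡φi : i ≡ φ i
      i≡φi = inj i (φ i) mᵢ m-φi (sym (both⇒fixed (φ i) m-φi (m-φi , into i mᵢ)))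

    φ-into : ∀ {i} → i ∈ X₁₀ → φ i ∈ X₀₁
    φ-into i∈ = ∈-X₀₁⁺ (φ-leaves i∈) (into _ (proj₁ (∈-X₁₀⁻ i∈)))

    φ-onto : ∀ {y} → y ∈ X₀₁ → ∃[ x ] x ∈ X₁₀ × φ x ≡ y
    φ-onto {y} y∈ with x , mₓ , refl ← onto y (proj₂ (∈-X₀₁⁻ y∈)) with m M x (suc j) in mₓ′
    ... | false = x , ∈-X₁₀⁺ mₓ mₓ′ , refl
    ... | true  = contradiction
                    (trans (sym mₓ) (subst (λ r → m M r j ≡ false) (both⇒fixed x mₓ (mₓ , mₓ′))
                                           (proj₁ (∈-X₀₁⁻ y∈))))
                    λ ()

    matching : Matching (inX10 M j) K L
    matching = record
      { pair      = φ
      ; pair-into = φ-into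
      ; pair-inj  = λ x∈ x′∈ → inj _ _ (proj₁ (∈-X₁₀⁻ x∈)) (proj₁ (∈-X₁₀⁻ x′∈))
      ; pair-onto = φ-onto
      ; pair-<    = λ x∈ → Equivalence.from (K<K⇔S≤S x∈ (φ-into x∈)) (sumDecr _ (proj₁ (∈-X₁₀⁻ x∈)))
      }

  module FromMatching (μ : Matching (inX10 M j) K L) where
    open Matching μ

    φ : Fin n → Fin n
    φ i = if m M i (suc j) then i else pair i

    φ-stays : ∀ {i} → m M i (suc j) ≡ true → φ i ≡ i
    φ-stays {i} mᵢ′ = cong (λ c → if c then i else pair i) mᵢ′

    φ-moves : ∀ {i} → i ∈ X₁₀ → φ i ≡ pair i
    φ-moves {i} i∈ = cong (λ c → if c then i else pair i) (proj₂ (∈-X₁₀⁻ i∈))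

    data Row (i : Fin n) : Set where
      stays : m M i (suc j) ≡ true → φ i ≡ i → Row i
      moves : i ∈ X₁₀ → φ i ≡ pair i → Row i

    row : ∀ {i} → m M i j ≡ true → Row i
    row {i} mᵢ with m M i (suc j) in mᵢ′
    ... | true  = stays mᵢ′ (φ-stays mᵢ′)
    ... | false = moves i∈ (φ-moves i∈) where i∈ = ∈-X₁₀⁺ mᵢ mᵢ′

    pair≢ : ∀ {i i′} → i ∈ X₁₀ → m M i′ j ≡ true → pair i ≢ i′
    pair≢ i∈ m-i′ refl = contradiction (trans (sym m-i′) (proj₁ (∈-X₀₁⁻ (pair-into i∈)))) λ ()

    φ-into : ∀ {i} → Row i → m M (φ i) (suc j) ≡ true
    φ-into (stays mᵢ′ e) = subst (λ r → m M r (suc j) ≡ true) (sym e) mᵢ′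
    φ-into (moves i∈ e)  = subst (λ r → m M r (suc j) ≡ true) (sym e) (proj₂ (∈-X₀₁⁻ (pair-into i∈)))

    φ-inj : ∀ {i i′} → Row i → Row i′ → m M i j ≡ true → m M i′ j ≡ true → φ i ≡ φ i′ → i ≡ i′
    φ-inj (stays _ e)  (stays _ e′)   _  _    eq = trans (sym e) (trans eq e′)
    φ-inj (moves i∈ e) (moves i′∈ e′) _  _    eq = pair-inj i∈ i′∈ (trans (sym e) (trans eq e′))
    φ-inj (moves i∈ e) (stays _ e′)   _  m-i′ eq = ⊥-elim (pair≢ i∈ m-i′ (trans (sym e) (trans eq e′)))
    φ-inj (stays _ e)  (moves i′∈ e′) mᵢ _    eq = ⊥-elim (pair≢ i′∈ mᵢ (trans (sym e′) (trans (sym eq) e)))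

    φ-onto : ∀ r → m M r (suc j) ≡ true → Σ (Fin n) λ i → (m M i j ≡ true) × (φ i ≡ r)
    φ-onto r mᵣ′ with m M r j in mᵣ
    ... | true  = r , mᵣ , φ-stays mᵣ′
    ... | false with x , x∈ , refl ← pair-onto (∈-X₀₁⁺ mᵣ mᵣ′) = x , proj₁ (∈-X₁₀⁻ x∈) , φ-moves x∈

    assignment : AssignmentMapping M j
    assignment = record
      { φ    = φ
      ; into = λ _ mᵢ → φ-into (row mᵢ)
      ; inj  = λ _ _ mᵢ m-i′ → φ-inj (row mᵢ) (row m-i′) mᵢ m-i′
      ; onto = φ-onto
      }

    φ-fixed : ∀ {i} → Row i → m M i j ≡ true → φ i ≡ i → (m M i j ≡ true) × (m M i (suc j) ≡ true)
    φ-fixed (stays mᵢ′ _) mᵢ _  = mᵢ , mᵢ′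
    φ-fixed (moves i∈ e)  mᵢ eq = ⊥-elim (pair≢ i∈ mᵢ (trans (sym e) eq))

    S-φ≤S : ∀ {i} → Row i → S M (φ i) j ≤ S M i j
    S-φ≤S     (stays _ e)  = ≤-reflexive (cong (λ r → S M r j) e)
    S-φ≤S {i} (moves i∈ e) = subst (λ r → S M r j ≤ S M i j) (sym e)
      (Equivalence.to (K<K⇔S≤S i∈ (pair-into i∈)) (pair-< i∈))

    optimal : IsOptimal assignment
    optimal = record
      { fixed⇒both = λ _ mᵢ → φ-fixed (row mᵢ) mᵢ
      ; both⇒fixed = λ _ _ (_ , mᵢ′) → φ-stays mᵢ′
      ; sumDecr    = λ _ mᵢ → S-φ≤S (row mᵢ)
      }

  optimal⇔Dyck : Σ (AssignmentMapping M j) IsOptimal ⇔ IsDyck (canonicalWord M j)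
  optimal⇔Dyck = mk⇔
    (λ (A , optimal) → matching⇒Dyck (inX10 M j) K L-unique L-descending (FromOptimal.matching A optimal))
    (λ dyck → let μ = Dyck⇒matching (inX10 M j) K _≟_ L-unique L-descending K-separated dyck
              in FromMatching.assignment μ , FromMatching.optimal μ)

proposition3p6 : ((w : List Letter) → IsDyck w → IsDyck (dualReverse w))
    × ((n k : ℕ) (M : Matrix n) → KUniform k M →
    (j : ℕ) → 1 ≤ j → j ≤ n ∸ 1 →
    (Σ (AssignmentMapping M j) IsOptimal) ⇔ IsDyck (canonicalWord M j))
proposition3p6 = Dyck-dualReverse , λ n k M _ j _ _ → CanonicalWord.optimal⇔Dyck M j
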